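{- Let $G$ be a finite bipartite graph with no isolated vertices in which every vertex of one of its bipartite classes is adjacent to at least one pendant vertex. Then $G$ satisfies Frankl's conjecture; in fact, every vertex of $G$ is rare in $G$.
   Context: A stable set of a graph is a set of pairwise non-adjacent vertices; it is maximal if no further vertex can be added while keeping it stable. A vertex $x$ of $G$ is rare in $G$ if it lies in at most half of the maximal stable sets of $G$. A pendant vertex is a vertex of degree $1$. A bipartite graph $G$ satisfies Frankl's conjecture if for every bipartition $(X,Y)$ of $V(G)$ into two stable sets, each of $X$ and $Y$ contains a vertex rare in $G$. -}

module Defs where

open import Data.Nat using (ℕ; zero; suc; _*_; _≤_)
open import Data.Fin using (Fin)
open import Data.Fin.Subset using (Subset; _∈_; _∉_; ∁; _∪_; ⁅_⁆; inside; outside)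
open import Data.Fin.Subset.Properties using (_∈?_)
open import Data.Fin.Properties using (all?)
open import Data.List using (List; []; _∷_; _++_; map; filter; length; allFin)
open import Data.Vec using (_∷_; [])
open import Data.Product using (_×_; Σ; ∃; _,_)
open import Relation.Nullary using (¬_; Dec)
open import Relation.Nullary.Decidable using (_×-dec_; _→-dec_; ¬?)
open import Relation.Binary.PropositionalEquality using (_≡_; _≢_)

record Graph (n : ℕ) : Set₁ where
  field
    _~_    : Fin n → Fin n → Set
    adj?   : ∀ x y → Dec (x ~ y)
    sym    : ∀ {x y} → x ~ y → y ~ x
    irrefl : ∀ {x} → ¬ (x ~ x)

module _ {n : ℕ} (G : Graph n) where
  open Graph G

  degree : Fin n → ℕ
  degree x = length (filter (adj? x) (allFin n))

  Pendant : Fin n → Set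
  Pendant x = degree x ≡ 1

  Isolated : Fin n → Set
  Isolated x = degree x ≡ 0

  NoIsolated : Set
  NoIsolated = ∀ x → ¬ Isolated x

  Stable : Subset n → Set
  Stable S = ∀ x y → x ∈ S → y ∈ S → ¬ (x ~ y)

  stable? : ∀ S → Dec (Stable S)
  stable? S = all? λ x → all? λ y → (x ∈? S) →-dec ((y ∈? S) →-dec ¬? (adj? x y))

  MaximalStable : Subset n → Set
  MaximalStable S = Stable S × (∀ v → v ∉ S → ¬ Stable (S ∪ ⁅ v ⁆))

  maximalStable? : ∀ S → Dec (MaximalStable S)
  maximalStable? S = stable? S ×-dec all? λ v → ¬? (v ∈? S) →-dec ¬? (stable? (S ∪ ⁅ v ⁆))

allSubsets : (n : ℕ) → List (Subset n)
allSubsets zero    = [] ∷ []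
allSubsets (suc n) = map (outside ∷_) (allSubsets n) ++ map (inside ∷_) (allSubsets n)

module _ {n : ℕ} (G : Graph n) where

  #maxStable : ℕ
  #maxStable = length (filter (maximalStable? G) (allSubsets n))

  #maxStableContaining : Fin n → ℕ
  #maxStableContaining x =
    length (filter (λ S → maximalStable? G S ×-dec (x ∈? S)) (allSubsets n))

  Rare : Fin n → Set
  Rare x = 2 * #maxStableContaining x ≤ #maxStable

  IsBipartition : Subset n → Set
  IsBipartition X = Stable G X × Stable G (∁ X)

  SatisfiesFrankl : Set
  SatisfiesFrankl = ∀ X → IsBipartition X →
    (Σ (Fin n) λ x → x ∈ X × Rare x) × (Σ (Fin n) λ y → y ∈ ∁ X × Rare y)

-- Let X be the class all of whose vertices have a pendant neighbour and Y its complement.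
-- A maximal stable set T is determined by C = T ∩ X: it consists of C and the vertices of Y
-- with no neighbour in C. Conversely every C ⊆ X arises this way: a vertex x ∈ X \ C cannot be
-- added because its pendant neighbour, whose only neighbour is x, belongs to the set.
-- Toggling a fixed x ∈ X in C is therefore an involution on the maximal stable sets, and it
-- exchanges those containing x with those avoiding x, so x is rare. A vertex y ∈ Y is rare
-- too: toggling a neighbour x of y sends every maximal stable set containing y, which avoids x,
-- to one containing x and hence avoiding y.
module Submission where

open import Defs
open import Data.Bool using (true; false; not)
open import Data.Bool.Properties using (not-involutive; ¬-not)
open import Data.Nat using (ℕ; suc; zero; _≤_; _+_; _*_; s≤s; z≤n)
open import Data.Nat.Properties using (+-suc; +-monoʳ-≤; +-identityʳ; module ≤-Reasoning)
open import Data.Fin using (Fin) renaming (zero to fzero)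
open import Data.Fin.Properties using (any?; all?) renaming (_≟_ to _≟ᶠ_)
open import Data.Fin.Subset using (Subset; _∈_; _∉_; ∁; _∪_; _∩_; ⁅_⁆; inside; outside; _⊆_)
open import Data.Fin.Subset.Properties
  using (_∈?_; x∈p∪q⁻; p⊆p∪q; q⊆p∪q; x∈p∩q⁺; x∈p∩q⁻; p∩q⊆q; x∈⁅x⁆; x∈⁅y⁆⇒x≡y; x∉p⇒x∈∁p;
         ⊆-antisym)
open import Data.Vec using ([]; _∷_; tabulate; lookup; updateAt; _[_]%=_)
open import Data.Vec.Properties
  using (lookup∘tabulate; []=⇒lookup; lookup⇒[]=; ∷-injectiveʳ; lookup∘updateAt; lookup∘updateAt′;
         updateAt-updateAt; updateAt-cong; []%=-id)
open import Data.List using (List; []; _∷_; map; filter; length; allFin)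
open import Data.List.Properties using (filter-none; length-removeAt′)
open import Data.List.Membership.Propositional using (_─_) renaming (_∈_ to _∈ˡ_)
open import Data.List.Membership.Propositional.Properties
  using (∈-filter⁺; ∈-filter⁻; ∈-allFin; ∈-map⁺; ∈-map⁻; ∈-++⁺ˡ; ∈-++⁺ʳ)
open import Data.List.Relation.Unary.Any using (here; there; index)
import Data.List.Relation.Unary.All as All
open import Data.List.Relation.Unary.AllPairs using ([]; _∷_)
open import Data.List.Relation.Unary.Unique.Propositional using (Unique)
import Data.List.Relation.Unary.Unique.Propositional.Properties as Unique
open import Data.Product using (_×_; Σ; ∃; _,_; proj₁; proj₂)
open import Data.Sum using (_⊎_; inj₁; inj₂)
open import Data.Empty using (⊥-elim)
open import Function using (_∘_; case_of_)
open import Relation.Nullary using (¬_; Dec; yes; no; does)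
open import Relation.Nullary.Decidable using (_×-dec_; _⊎-dec_; _→-dec_; ¬?; dec-true)
open import Relation.Unary using (Pred; Decidable)
open import Relation.Unary.Properties using (_∩?_; ∁?)
open import Relation.Binary.PropositionalEquality
  using (_≡_; _≢_; refl; sym; trans; cong; subst; module ≡-Reasoning)

module _ {A : Set} where

  ∈-─⁺ : ∀ {x z} {ys : List A} (p : x ∈ˡ ys) → z ∈ˡ ys → z ≢ x → z ∈ˡ ys ─ p
  ∈-─⁺ (here refl) (here refl) z≢x = ⊥-elim (z≢x refl)
  ∈-─⁺ (here refl) (there q)   _   = q
  ∈-─⁺ (there p)   (here e)    _   = here e
  ∈-─⁺ (there p)   (there q)   z≢x = there (∈-─⁺ p q z≢x)

  length-≤-injection : {xs ys : List A} (f : A → A) → Unique xs →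
    (∀ {a b} → a ∈ˡ xs → b ∈ˡ xs → f a ≡ f b → a ≡ b) →
    (∀ {a} → a ∈ˡ xs → f a ∈ˡ ys) →
    length xs ≤ length ys
  length-≤-injection {[]}     f _              _   _    = z≤n
  length-≤-injection {x ∷ xs} {ys} f (x∉xs ∷ !xs) inj into = begin
    suc (length xs)            ≤⟨ s≤s (length-≤-injection f !xs (λ a b → inj (there a) (there b)) into′) ⟩
    suc (length (ys ─ fx∈ys))  ≡⟨ sym (length-removeAt′ ys (index fx∈ys)) ⟩
    length ys                  ∎
    where
    open ≤-Reasoning
    fx∈ys = into (here refl)
    into′ : ∀ {a} → a ∈ˡ xs → f a ∈ˡ ys ─ fx∈ys
    into′ a∈ = ∈-─⁺ fx∈ys (into (there a∈))
      (λ e → All.lookup x∉xs a∈ (sym (inj (there a∈) (here refl) e)))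

  involution-injective : ∀ {ℓ} {P : Pred A ℓ} (f : A → A) → (∀ {a} → P a → f (f a) ≡ a) →
    ∀ {a b} → P a → P b → f a ≡ f b → a ≡ b
  involution-injective f f-involutive {a} {b} pa pb fa≡fb = begin
    a        ≡⟨ sym (f-involutive pa) ⟩
    f (f a)  ≡⟨ cong f fa≡fb ⟩
    f (f b)  ≡⟨ f-involutive pb ⟩
    b        ∎
    where open ≡-Reasoning

  length-≡1⇒∈-unique : ∀ {a b} {xs : List A} → length xs ≡ 1 → a ∈ˡ xs → b ∈ˡ xs → a ≡ b
  length-≡1⇒∈-unique {xs = _ ∷ []} _ (here refl) (here refl) = refl

  module _ {p q} {P : Pred A p} {Q : Pred A q} (P? : Decidable P) (Q? : Decidable Q) where

    length-filter-split : ∀ xs →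
      length (filter P? xs) ≡ length (filter (P? ∩? Q?) xs) + length (filter (P? ∩? ∁? Q?) xs)
    length-filter-split [] = refl
    length-filter-split (x ∷ xs) with ih ← length-filter-split xs | does (P? x) | does (Q? x)
    ... | false | _     = ih
    ... | true  | true  = cong suc ih
    ... | true  | false = trans (cong suc ih) (sym (+-suc _ _))

∈-allSubsets : ∀ n (S : Subset n) → S ∈ˡ allSubsets n
∈-allSubsets zero    []            = here refl
∈-allSubsets (suc n) (outside ∷ S) = ∈-++⁺ˡ (∈-map⁺ (outside ∷_) (∈-allSubsets n S))
∈-allSubsets (suc n) (inside ∷ S)  = ∈-++⁺ʳ _ (∈-map⁺ (inside ∷_) (∈-allSubsets n S))

allSubsets-unique : ∀ n → Unique (allSubsets n)
allSubsets-unique zero    = All.[] ∷ []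
allSubsets-unique (suc n) =
  Unique.++⁺ (Unique.map⁺ ∷-injectiveʳ (allSubsets-unique n))
             (Unique.map⁺ ∷-injectiveʳ (allSubsets-unique n))
             disjoint
  where
  disjoint : ∀ {S} → ¬ (S ∈ˡ map (outside ∷_) (allSubsets n) × S ∈ˡ map (inside ∷_) (allSubsets n))
  disjoint (p , q) with ∈-map⁻ (outside ∷_) p | ∈-map⁻ (inside ∷_) q
  ... | _ , _ , refl | _ , _ , ()

module _ {n : ℕ} where

  fromDec : ∀ {ℓ} {P : Pred (Fin n) ℓ} → Decidable P → Subset n
  fromDec P? = tabulate (does ∘ P?)

  ∈-fromDec⁺ : ∀ {ℓ} {P : Pred (Fin n) ℓ} (P? : Decidable P) {v} → P v → v ∈ fromDec P?
  ∈-fromDec⁺ P? {v} pv = lookup⇒[]= v _ (trans (lookup∘tabulate _ v) (dec-true (P? v) pv))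

  ∈-fromDec⁻ : ∀ {ℓ} {P : Pred (Fin n) ℓ} (P? : Decidable P) {v} → v ∈ fromDec P? → P v
  ∈-fromDec⁻ P? {v} v∈ = witness (P? v) (trans (sym (lookup∘tabulate _ v)) ([]=⇒lookup v∈))
    where
    witness : ∀ {a} {A : Set a} (a? : Dec A) → does a? ≡ true → A
    witness (yes a) _ = a
    witness (no _)  ()

  toggle : Fin n → Subset n → Subset n
  toggle x C = C [ x ]%= not

  toggle-involutive : ∀ x C → toggle x (toggle x C) ≡ C
  toggle-involutive x C = begin
    updateAt (updateAt C x not) x not  ≡⟨ updateAt-updateAt x C ⟩
    updateAt C x (not ∘ not)           ≡⟨ updateAt-cong x not-involutive C ⟩
    updateAt C x (λ b → b)             ≡⟨ []%=-id C x ⟩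
    C                                  ∎
    where open ≡-Reasoning

  ∉⇒∈-toggle : ∀ {x C} → x ∉ C → x ∈ toggle x C
  ∉⇒∈-toggle {x} {C} x∉C = lookup⇒[]= x _ (begin
    lookup (toggle x C) x  ≡⟨ lookup∘updateAt x C ⟩
    not (lookup C x)       ≡⟨ cong not (¬-not (x∉C ∘ lookup⇒[]= x C)) ⟩
    true                   ∎)
    where open ≡-Reasoning

  ∈⇒∉-toggle : ∀ {x C} → x ∈ C → x ∉ toggle x C
  ∈⇒∉-toggle {x} {C} x∈C x∈C′ = case true≡false of λ ()
    where
    open ≡-Reasoning
    true≡false : true ≡ false
    true≡false = begin
      true                   ≡⟨ []=⇒lookup x∈C′ ⟨
      lookup (toggle x C) x  ≡⟨ lookup∘updateAt x C ⟩
      not (lookup C x)       ≡⟨ cong not ([]=⇒lookup x∈C) ⟩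
      false                  ∎

  ∈-toggle⁻ : ∀ {x u C} → u ∈ toggle x C → u ≢ x → u ∈ C
  ∈-toggle⁻ {x} {u} {C} u∈ u≢x =
    lookup⇒[]= u C (trans (sym (lookup∘updateAt′ u x u≢x C)) ([]=⇒lookup u∈))

  toggle-⊆ : ∀ {x C D} → x ∈ D → C ⊆ D → toggle x C ⊆ D
  toggle-⊆ {x} x∈D C⊆D {u} u∈ with u ≟ᶠ x
  ... | yes refl = x∈D
  ... | no u≢x   = C⊆D (∈-toggle⁻ u∈ u≢x)

module _ {n : ℕ} (G : Graph n) where
  open Graph G using (_~_; adj?; irrefl) renaming (sym to ~-sym)

  neighbour : ∀ {v} → ¬ Isolated G v → ∃ (v ~_)
  neighbour {v} v-not-isolated with any? (adj? v)
  ... | yes nb   = nb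
  ... | no no-nb = ⊥-elim (v-not-isolated
        (cong length (filter-none (adj? v) {xs = allFin n}
          (All.tabulate (λ {u} _ v~u → no-nb (u , v~u))))))

  pendant-neighbour-unique : ∀ {y a b} → Pendant G y → y ~ a → y ~ b → a ≡ b
  pendant-neighbour-unique {y} {a} {b} pendant y~a y~b = length-≡1⇒∈-unique pendant
    (∈-filter⁺ (adj? y) (∈-allFin a) y~a) (∈-filter⁺ (adj? y) (∈-allFin b) y~b)

  bipartition-edge : ∀ {X x y} → IsBipartition G X → x ~ y → (x ∈ X × y ∈ ∁ X) ⊎ (x ∈ ∁ X × y ∈ X)
  bipartition-edge {X} {x} {y} (stX , st∁X) x~y with x ∈? X | y ∈? X
  ... | yes x∈X | yes y∈X = ⊥-elim (stX x y x∈X y∈X x~y)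
  ... | yes x∈X | no  y∉X = inj₁ (x∈X , x∉p⇒x∈∁p y∉X)
  ... | no  x∉X | yes y∈X = inj₂ (x∉p⇒x∈∁p x∉X , y∈X)
  ... | no  x∉X | no  y∉X = ⊥-elim (st∁X x y (x∉p⇒x∈∁p x∉X) (x∉p⇒x∈∁p y∉X) x~y)

  stable-∪⁅⁆ : ∀ {S v} → Stable G S → (∀ u → u ∈ S → ¬ u ~ v) → Stable G (S ∪ ⁅ v ⁆)
  stable-∪⁅⁆ {S} {v} stS no-nb p q p∈ q∈ p~q with x∈p∪q⁻ S ⁅ v ⁆ p∈ | x∈p∪q⁻ S ⁅ v ⁆ q∈
  ... | inj₁ p∈S | inj₁ q∈S = stS p q p∈S q∈S p~q
  ... | inj₁ p∈S | inj₂ q∈v rewrite x∈⁅y⁆⇒x≡y v q∈v = no-nb p p∈S p~q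
  ... | inj₂ p∈v | inj₁ q∈S rewrite x∈⁅y⁆⇒x≡y v p∈v = no-nb q q∈S (~-sym p~q)
  ... | inj₂ p∈v | inj₂ q∈v rewrite x∈⁅y⁆⇒x≡y v p∈v | x∈⁅y⁆⇒x≡y v q∈v = irrefl p~q

  rare-by-involution : ∀ v (f : Subset n → Subset n) →
    (∀ {S} → MaximalStable G S → MaximalStable G (f S)) →
    (∀ {S} → MaximalStable G S → f (f S) ≡ S) →
    (∀ {S} → MaximalStable G S → v ∈ S → v ∉ f S) →
    Rare G v
  rare-by-involution v f f-maximal f-involutive f-removes = begin
    2 * length containing
      ≡⟨ cong (length containing +_) (+-identityʳ (length containing)) ⟩
    length containing + length containing
      ≤⟨ +-monoʳ-≤ (length containing) (length-≤-injection f unique injective into) ⟩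
    length containing + length avoiding
      ≡⟨ length-filter-split (maximalStable? G) (v ∈?_) (allSubsets n) ⟨
    #maxStable G
      ∎
    where
    open ≤-Reasoning
    containing? = maximalStable? G ∩? (v ∈?_)
    avoiding?   = maximalStable? G ∩? ∁? (v ∈?_)
    containing = filter containing? (allSubsets n)
    avoiding   = filter avoiding? (allSubsets n)

    unique : Unique containing
    unique = Unique.filter⁺ containing? (allSubsets-unique n)

    maximal-containing : ∀ {S} → S ∈ˡ containing → MaximalStable G S × v ∈ S
    maximal-containing = proj₂ ∘ ∈-filter⁻ containing? {xs = allSubsets n}

    injective : ∀ {S T} → S ∈ˡ containing → T ∈ˡ containing → f S ≡ f T → S ≡ T
    injective S∈ T∈ =
      involution-injective f f-involutive (proj₁ (maximal-containing S∈)) (proj₁ (maximal-containing T∈))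

    into : ∀ {S} → S ∈ˡ containing → f S ∈ˡ avoiding
    into {S} S∈ with maximal-containing S∈
    ... | S-maximal , v∈S =
      ∈-filter⁺ avoiding? (∈-allSubsets n (f S)) (f-maximal S-maximal , f-removes S-maximal v∈S)

  frankl-if-all-rare : ∀ {v} → ¬ Isolated G v → (∀ x → Rare G x) → SatisfiesFrankl G
  frankl-if-all-rare {v} v-not-isolated rare X bip with neighbour v-not-isolated
  ... | u , v~u with bipartition-edge bip v~u
  ... | inj₁ (v∈X , u∈∁X) = (v , v∈X , rare v) , (u , u∈∁X , rare u)
  ... | inj₂ (v∈∁X , u∈X) = (u , u∈X , rare u) , (v , v∈∁X , rare v)

module PendantBipartite {n : ℕ} (G : Graph n) (X : Subset n) (bip : IsBipartition G X)
  (pendant : ∀ x → x ∈ X → Σ (Fin n) λ y → Graph._~_ G x y × Pendant G y) where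

  open Graph G using (_~_; adj?) renaming (sym to ~-sym)

  stX : Stable G X
  stX = proj₁ bip

  st∁X : Stable G (∁ X)
  st∁X = proj₂ bip

  InClosure : Subset n → Fin n → Set
  InClosure C v = v ∈ C ⊎ (v ∉ X × (∀ u → u ∈ C → ¬ u ~ v))

  inClosure? : ∀ C → Decidable (InClosure C)
  inClosure? C v = (v ∈? C) ⊎-dec (¬? (v ∈? X) ×-dec all? λ u → (u ∈? C) →-dec ¬? (adj? u v))

  close : Subset n → Subset n
  close C = fromDec (inClosure? C)

  ∈-close⁺ : ∀ {C v} → InClosure C v → v ∈ close C
  ∈-close⁺ {C} = ∈-fromDec⁺ (inClosure? C)

  ∈-close⁻ : ∀ {C v} → v ∈ close C → InClosure C v
  ∈-close⁻ {C} = ∈-fromDec⁻ (inClosure? C)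

  ⊆-close : ∀ {C} → C ⊆ close C
  ⊆-close = ∈-close⁺ ∘ inj₁

  close-∩ : ∀ {C} → C ⊆ X → close C ∩ X ≡ C
  close-∩ {C} C⊆X = ⊆-antisym ⊆C (λ u∈C → x∈p∩q⁺ (⊆-close u∈C , C⊆X u∈C))
    where
    ⊆C : close C ∩ X ⊆ C
    ⊆C u∈ with x∈p∩q⁻ (close C) X u∈
    ... | u∈close , u∈X with ∈-close⁻ u∈close
    ...   | inj₁ u∈C       = u∈C
    ...   | inj₂ (u∉X , _) = ⊥-elim (u∉X u∈X)

  close-stable : ∀ {C} → C ⊆ X → Stable G (close C)
  close-stable {C} C⊆X p q p∈ q∈ p~q with ∈-close⁻ p∈ | ∈-close⁻ q∈
  ... | inj₁ p∈C          | inj₁ q∈C          = stX p q (C⊆X p∈C) (C⊆X q∈C) p~q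
  ... | inj₂ (p∉X , _)    | inj₂ (q∉X , _)    = st∁X p q (x∉p⇒x∈∁p p∉X) (x∉p⇒x∈∁p q∉X) p~q
  ... | inj₁ p∈C          | inj₂ (_ , q-free) = q-free p p∈C p~q
  ... | inj₂ (_ , p-free) | inj₁ q∈C          = p-free q q∈C (~-sym p~q)

  close-maximalStable : ∀ {C} → C ⊆ X → MaximalStable G (close C)
  close-maximalStable {C} C⊆X = close-stable C⊆X , λ w w∉ st → w∉ (∈-close⁺ (addable w w∉ st))
    where
    old : ∀ {u w} → u ∈ close C → u ∈ close C ∪ ⁅ w ⁆
    old {w = w} = p⊆p∪q ⁅ w ⁆

    new : ∀ w → w ∈ close C ∪ ⁅ w ⁆
    new w = q⊆p∪q (close C) ⁅ w ⁆ (x∈⁅x⁆ w)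

    addable : ∀ w → w ∉ close C → Stable G (close C ∪ ⁅ w ⁆) → InClosure C w
    addable w w∉ st with w ∈? X
    ... | no w∉X = inj₂ (w∉X , λ u u∈C u~w → st u w (old (⊆-close u∈C)) (new w) u~w)
    ... | yes w∈X with pendant w w∈X
    ...   | y , w~y , y-pendant = ⊥-elim (st w y (new w) (old (∈-close⁺ y-free)) w~y)
      where
      y-free : InClosure C y
      y-free = inj₂ ((λ y∈X → stX w y w∈X y∈X w~y) , λ u u∈C u~y →
        w∉ (⊆-close (subst (_∈ C) (pendant-neighbour-unique G y-pendant (~-sym u~y) (~-sym w~y)) u∈C)))

  close-∩-maximalStable : ∀ {T} → MaximalStable G T → close (T ∩ X) ≡ T
  close-∩-maximalStable {T} (stT , T-maximal) = ⊆-antisym ⊆T T⊆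
    where
    T⊆ : T ⊆ close (T ∩ X)
    T⊆ {v} v∈T with v ∈? X
    ... | yes v∈X = ⊆-close (x∈p∩q⁺ (v∈T , v∈X))
    ... | no v∉X  = ∈-close⁺ (inj₂ (v∉X , λ u u∈ u~v → stT u v (proj₁ (x∈p∩q⁻ T X u∈)) v∈T u~v))

    ⊆T : close (T ∩ X) ⊆ T
    ⊆T {v} v∈ with ∈-close⁻ v∈ | v ∈? T
    ... | inj₁ v∈T∩X        | _       = proj₁ (x∈p∩q⁻ T X v∈T∩X)
    ... | inj₂ _            | yes v∈T = v∈T
    ... | inj₂ (v∉X , free) | no v∉T  = ⊥-elim (T-maximal v v∉T (stable-∪⁅⁆ G stT no-nb))
      where
      no-nb : ∀ u → u ∈ T → ¬ u ~ v
      no-nb u u∈T u~v with u ∈? X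
      ... | yes u∈X = free u (x∈p∩q⁺ (u∈T , u∈X)) u~v
      ... | no u∉X  = st∁X u v (x∉p⇒x∈∁p u∉X) (x∉p⇒x∈∁p v∉X) u~v

  switch : Fin n → Subset n → Subset n
  switch x T = close (toggle x (T ∩ X))

  module _ {x : Fin n} (x∈X : x ∈ X) where

    toggle-∩-⊆ : ∀ T → toggle x (T ∩ X) ⊆ X
    toggle-∩-⊆ T = toggle-⊆ x∈X (p∩q⊆q T X)

    switch-maximalStable : ∀ T → MaximalStable G (switch x T)
    switch-maximalStable T = close-maximalStable (toggle-∩-⊆ T)

    switch-involutive : ∀ {T} → MaximalStable G T → switch x (switch x T) ≡ T
    switch-involutive {T} T-maximal = begin
      close (toggle x (close (toggle x (T ∩ X)) ∩ X))  ≡⟨ cong (close ∘ toggle x) (close-∩ (toggle-∩-⊆ T)) ⟩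
      close (toggle x (toggle x (T ∩ X)))              ≡⟨ cong close (toggle-involutive x (T ∩ X)) ⟩
      close (T ∩ X)                                    ≡⟨ close-∩-maximalStable T-maximal ⟩
      T                                                ∎
      where open ≡-Reasoning

    ∈-switch : ∀ {T} → x ∈ switch x T → x ∉ T
    ∈-switch {T} x∈ x∈T = ∈⇒∉-toggle (x∈p∩q⁺ (x∈T , x∈X))
      (subst (x ∈_) (close-∩ (toggle-∩-⊆ T)) (x∈p∩q⁺ (x∈ , x∈X)))

    ∉-switch : ∀ {T} → x ∉ T → x ∈ switch x T
    ∉-switch {T} x∉T = ⊆-close (∉⇒∈-toggle (x∉T ∘ proj₁ ∘ x∈p∩q⁻ T X))

    rare-by-switch : ∀ {v} → (∀ {T} → MaximalStable G T → v ∈ T → v ∉ switch x T) → Rare G v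
    rare-by-switch = rare-by-involution G _ (switch x) (λ {T} _ → switch-maximalStable T) switch-involutive

    rare-∈X : Rare G x
    rare-∈X = rare-by-switch (λ _ x∈T x∈ → ∈-switch x∈ x∈T)

    rare-neighbour : ∀ {v} → v ~ x → Rare G v
    rare-neighbour {v} v~x = rare-by-switch λ {T} (stT , _) v∈T v∈ →
      proj₁ (switch-maximalStable T) v x v∈ (∉-switch (λ x∈T → stT v x v∈T x∈T v~x)) v~x

  all-rare : NoIsolated G → ∀ v → Rare G v
  all-rare no-isolated v with v ∈? X | neighbour G (no-isolated v)
  ... | yes v∈X | _     = rare-∈X v∈X
  ... | no v∉X  | u , v~u with bipartition-edge G bip v~u
  ...   | inj₁ (v∈X , _) = ⊥-elim (v∉X v∈X)
  ...   | inj₂ (_ , u∈X) = rare-neighbour u∈X v~u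

corollary3p9 : (n : ℕ) (G : Graph (suc n)) →
    NoIsolated G →
    (Σ _ λ X → IsBipartition G X ×
    (∀ x → x ∈ X → Σ (Fin (suc n)) λ y → Graph._~_ G x y × Pendant G y)) →
    SatisfiesFrankl G × (∀ x → Rare G x)
corollary3p9 n G no-isolated (X , bip , pendant) = frankl-if-all-rare G (no-isolated fzero) rare , rare
  where
  rare = PendantBipartite.all-rare G X bip pendant no-isolated
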